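{- The map $$F:(\lvert\mathrm{PCD}(\mathbf{Set},\mathbf{Bij})\rvert,\succeq,\sqcup)\to(\mathrm{FinSupp}_{\mathbb N}(\mathbb N\setminus\{1\}),\ge,+),\qquad [f]\mapsto\big(i\mapsto\varphi_i(f)\big)$$ is a well-defined isomorphism of ordered monoids, where for $f:X\to Y$, $\varphi_i(f)=\#\{y\in Y\mid\#f^{ -1}(y)=i\}$.
   Context: $\mathbb N=\{0,1,2,\dots\}$. $\mathbf{Set}$ is the symmetric monoidal category of finite sets and functions with monoidal product disjoint union $\sqcup$; $\mathbf{Bij}$ is its subcategory of all finite sets and bijections. For functions $f,g$ between finite sets, $f\succeq g$ means there exist a finite set $Z$, bijections $\xi_1,\xi_2$ and a function $j$ between finite sets with $\xi_2\circ(f\sqcup 1_Z)\circ\xi_1=g\sqcup j$; this is a preorder compatible with $\sqcup$, and $(\lvert\mathrm{PCD}(\mathbf{Set},\mathbf{Bij})\rvert,\succeq,\sqcup)$ is the ordered monoid of equivalence classes $[f]$ under mutual $\succeq$, with $[f]\sqcup[g]=[f\sqcup g]$. For a set $S$, $\mathrm{FinSupp}_{\mathbb N}(S)$ is the set of functions $h:S\to\mathbb N$ with $h(s)\neq0$ for only finitely many $s$, ordered pointwise ($h\ge k$ iff $h(s)\ge k(s)$ for all $s$) and with pointwise addition. An isomorphism of ordered monoids is a bijective monoid homomorphism that preserves and reflects the order. -}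

module Defs where

open import Data.Nat using (ℕ; zero; suc; _+_; _≤_)
open import Data.Nat.Properties using (_≟_)
open import Data.Fin using (Fin; _↑ˡ_; _↑ʳ_; splitAt)
open import Data.Fin.Properties using () renaming (_≟_ to _≟ᶠ_)
open import Data.List using (List; length; filter)
open import Data.Sum using ([_,_])
open import Data.Product using (Σ; Σ-syntax; _×_)
open import Function using (_∘_; id)
open import Function.Bundles using (_⤖_; Bijection)
open import Relation.Binary.PropositionalEquality using (_≡_; _≢_)

open import Data.List.Base using () renaming (tabulate to tabulateL)

allFinL : (n : ℕ) → List (Fin n)
allFinL n = tabulateL id

-- A function between finite sets, with the finite sets represented
-- (up to bijection) by standard finite sets Fin dom, Fin cod.
record FinFun : Set where
  constructor mkFun
  field
    dom : ℕ
    cod : ℕ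
    fun : Fin dom → Fin cod
open FinFun public

_⊔ᶠ_ : ∀ {a b c d} → (Fin a → Fin b) → (Fin c → Fin d) → Fin (a + c) → Fin (b + d)
_⊔ᶠ_ {a} {b} {c} {d} f g = [ (λ x → f x ↑ˡ d) , (λ x → b ↑ʳ g x) ] ∘ splitAt a

_⊔_ : FinFun → FinFun → FinFun
f ⊔ g = mkFun (dom f + dom g) (cod f + cod g) (fun f ⊔ᶠ fun g)

emptyFun : FinFun
emptyFun = mkFun 0 0 id

_≽_ : FinFun → FinFun → Set
f ≽ g =
  Σ[ z ∈ ℕ ] Σ[ w ∈ ℕ ] Σ[ w' ∈ ℕ ]
  Σ[ ξ₁ ∈ (Fin (dom g + w) ⤖ Fin (dom f + z)) ]
  Σ[ ξ₂ ∈ (Fin (cod f + z) ⤖ Fin (cod g + w')) ]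
  Σ[ j ∈ (Fin w → Fin w') ]
    (∀ x → Bijection.to ξ₂ ((fun f ⊔ᶠ id) (Bijection.to ξ₁ x)) ≡ (fun g ⊔ᶠ j) x)

-- mutual ≽ : the equivalence whose classes form |PCD(Set,Bij)|
_≈_ : FinFun → FinFun → Set
f ≈ g = (f ≽ g) × (g ≽ f)

preimageSize : (f : FinFun) → Fin (cod f) → ℕ
preimageSize f y = length (filter (λ x → fun f x ≟ᶠ y) (allFinL (dom f)))

φ : ℕ → FinFun → ℕ
φ i f = length (filter (λ y → preimageSize f y ≟ i) (allFinL (cod f)))

-- finitely supported h : ℕ∖{1} → ℕ  (value at 1 is irrelevant)
FinSupp : (ℕ → ℕ) → Set
FinSupp h = Σ[ N ∈ ℕ ] (∀ i → N ≤ i → i ≢ 1 → h i ≡ 0)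

-- φ(f) is the profile of fibre sizes of f.  Fibre sizes add up under ⊔, and they are
-- preserved by conjugation with bijections; conversely two functions with the same
-- profile are conjugate: first match codomain points having equal fibre sizes, then
-- biject the domains fibre by fibre.  Now f ≽ g says that f ⊔ 1_Z is conjugate to
-- g ⊔ j, and 1_Z only contributes to φ₁, hence ≽ is ≥ on the profiles away from 1;
-- for the converse, j realises the excess profile of f over g by disjoint unions of
-- maps onto a point.  The same realisation gives surjectivity.
module Submission where

open import Data.Empty using (⊥-elim)
open import Data.Fin using (Fin; zero; suc; _↑ˡ_; _↑ʳ_)
open import Data.Fin.Permutation using (Permutation; _⟨$⟩ʳ_; _⟨$⟩ˡ_; flip; inverseˡ; inverseʳ)
open import Data.Fin.Properties
  using (+↔⊎; splitAt-↑ˡ; splitAt-↑ʳ; ↑ˡ-injective; ↑ʳ-injective; suc-injective)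
  renaming (_≟_ to _≟ᶠ_)
open import Data.List using (length; filter; tabulate)
open import Data.Nat as ℕ using (ℕ; zero; suc; _+_; _*_; _∸_; _≤_; _<_; z≤n; s≤s)
import Data.Nat.Properties as ℕ
open import Data.Product using (Σ; Σ-syntax; _×_; _,_; proj₁; proj₂; map₂)
open import Data.Sum using (_⊎_; inj₁; inj₂; [_,_])
open import Data.Sum.Function.Propositional using (_⊎-↔_)
open import Function using (_∘_; id)
open import Function.Bundles using (_↔_; _⇔_; Inverse; Injection; mk↔ₛ′; mk⇔)
open import Function.Definitions using (Injective)
open import Function.Properties.Bijection using (⤖⇒↔)
open import Function.Properties.Inverse using (↔-trans; ↔-sym; ↔⇒↣; ↔⇒⤖)
open import Relation.Binary using (DecidableEquality)
open import Relation.Binary.PropositionalEquality hiding ([_])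
open import Relation.Nullary using (Dec; yes; no; ¬_; Irrelevant)
open import Axiom.UniquenessOfIdentityProofs using (module Decidable⇒UIP)
open import Algebra.Properties.CommutativeMonoid.Sum ℕ.+-0-commutativeMonoid
  using (sum; sum-cong-≗; sum-permute)

open import Defs

indicator : ∀ {p} {P : Set p} → Dec P → ℕ
indicator (yes _) = 1
indicator (no _)  = 0

indicator-cong : ∀ {p q} {P : Set p} {Q : Set q} → (P → Q) → (Q → P) →
                 (P? : Dec P) (Q? : Dec Q) → indicator P? ≡ indicator Q?
indicator-cong P→Q Q→P (yes _) (yes _) = refl
indicator-cong P→Q Q→P (yes p) (no ¬q) = ⊥-elim (¬q (P→Q p))
indicator-cong P→Q Q→P (no ¬p) (yes q) = ⊥-elim (¬p (Q→P q))
indicator-cong P→Q Q→P (no _)  (no _)  = refl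

indicator-yes : ∀ {p} {P : Set p} → P → (P? : Dec P) → indicator P? ≡ 1
indicator-yes p (yes _) = refl
indicator-yes p (no ¬p) = ⊥-elim (¬p p)

indicator-no : ∀ {p} {P : Set p} → ¬ P → (P? : Dec P) → indicator P? ≡ 0
indicator-no ¬p (yes p) = ⊥-elim (¬p p)
indicator-no ¬p (no _)  = refl

indicator↔Fin : ∀ {p} {P : Set p} → Irrelevant P → (P? : Dec P) → P ↔ Fin (indicator P?)
indicator↔Fin irr (yes p) = mk↔ₛ′ (λ _ → zero) (λ _ → p) (λ { zero → refl }) (irr p)
indicator↔Fin irr (no ¬p) = mk↔ₛ′ (⊥-elim ∘ ¬p) (λ ()) (λ ()) (⊥-elim ∘ ¬p)

Σ-Fin-suc↔ : ∀ {p n} {P : Fin (suc n) → Set p} → Σ (Fin (suc n)) P ↔ (P zero ⊎ Σ (Fin n) (P ∘ suc))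
Σ-Fin-suc↔ = mk↔ₛ′ (λ { (zero , p) → inj₁ p ; (suc x , p) → inj₂ (x , p) })
                   [ (zero ,_) , (λ (x , p) → suc x , p) ]
                   (λ { (inj₁ _) → refl ; (inj₂ _) → refl })
                   (λ { (zero , _) → refl ; (suc _ , _) → refl })

Fibre : ∀ {A B : Set} → (A → B) → B → Set
Fibre {A} F y = Σ[ x ∈ A ] F x ≡ y

Σ-congʳ-↔ : ∀ {B : Set} {P Q : B → Set} → (∀ y → P y ↔ Q y) → Σ B P ↔ Σ B Q
Σ-congʳ-↔ P↔Q = mk↔ₛ′ (map₂ (Inverse.to (P↔Q _))) (map₂ (Inverse.from (P↔Q _)))
  (λ (y , q) → cong (y ,_) (Inverse.strictlyInverseˡ (P↔Q y) q))
  (λ (y , p) → cong (y ,_) (Inverse.strictlyInverseʳ (P↔Q y) p))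

↔Σ-Fibre : ∀ {A B : Set} (F : A → B) → A ↔ Σ B (Fibre F)
↔Σ-Fibre F = mk↔ₛ′ (λ x → F x , x , refl) (proj₁ ∘ proj₂) (λ { (_ , _ , refl) → refl }) (λ _ → refl)

fibrewise-↔⇒↔ : ∀ {A C B : Set} {F : A → B} {G : C → B} → (∀ y → Fibre F y ↔ Fibre G y) →
                Σ[ ξ ∈ C ↔ A ] (∀ x → F (Inverse.to ξ x) ≡ G x)
fibrewise-↔⇒↔ {F = F} {G} F↔G =
  ↔-trans (↔Σ-Fibre G) (↔-trans (Σ-congʳ-↔ (↔-sym ∘ F↔G)) (↔-sym (↔Σ-Fibre F))) ,
  λ x → proj₂ (Inverse.from (F↔G (G x)) (x , refl))

module Multiplicity {B : Set} (_≟_ : DecidableEquality B) where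

  multiplicity : ∀ {n} → (Fin n → B) → B → ℕ
  multiplicity F y = sum (λ x → indicator (F x ≟ y))

  length-filter-tabulate : ∀ {m n} (F : Fin n → B) (g : Fin m → Fin n) y →
                           length (filter (λ x → F x ≟ y) (tabulate g)) ≡ multiplicity (F ∘ g) y
  length-filter-tabulate {zero}  F g y = refl
  length-filter-tabulate {suc m} F g y with F (g zero) ≟ y
  ... | yes _ = cong suc (length-filter-tabulate F (g ∘ suc) y)
  ... | no _  = length-filter-tabulate F (g ∘ suc) y

  multiplicity-cong : ∀ {n} {F G : Fin n → B} → F ≗ G → ∀ y → multiplicity F y ≡ multiplicity G y
  multiplicity-cong F≗G y = sum-cong-≗ (λ x → cong (λ v → indicator (v ≟ y)) (F≗G x))

  multiplicity-+ : ∀ m {n} (F : Fin (m + n) → B) y →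
                   multiplicity F y ≡ multiplicity (F ∘ (_↑ˡ n)) y + multiplicity (F ∘ (m ↑ʳ_)) y
  multiplicity-+ zero    F y = refl
  multiplicity-+ (suc m) F y = trans (cong (indicator (F zero ≟ y) +_) (multiplicity-+ m (F ∘ suc) y))
                                     (sym (ℕ.+-assoc (indicator (F zero ≟ y)) _ _))

  multiplicity-∘-permutation : ∀ {m n} (F : Fin n → B) (π : Permutation m n) y →
                               multiplicity (F ∘ (π ⟨$⟩ʳ_)) y ≡ multiplicity F y
  multiplicity-∘-permutation F π y = sym (sum-permute (λ x → indicator (F x ≟ y)) π)

  multiplicity-≡0 : ∀ {n} {F : Fin n → B} {y} → (∀ x → F x ≢ y) → multiplicity F y ≡ 0
  multiplicity-≡0 {zero}  F≢y = refl
  multiplicity-≡0 {suc n} {F} {y} F≢y with F zero ≟ y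
  ... | yes F0≡y = ⊥-elim (F≢y zero F0≡y)
  ... | no _     = multiplicity-≡0 (F≢y ∘ suc)

  multiplicity-≡n : ∀ {n} {F : Fin n → B} {y} → (∀ x → F x ≡ y) → multiplicity F y ≡ n
  multiplicity-≡n {zero}  F≡y = refl
  multiplicity-≡n {suc n} {F} {y} F≡y with F zero ≟ y
  ... | yes _    = cong suc (multiplicity-≡n (F≡y ∘ suc))
  ... | no F0≢y  = ⊥-elim (F0≢y (F≡y zero))

  multiplicity-≤ : ∀ {n} (F : Fin n → B) y → multiplicity F y ≤ n
  multiplicity-≤ {zero}  F y = z≤n
  multiplicity-≤ {suc n} F y with F zero ≟ y
  ... | yes _ = s≤s (multiplicity-≤ (F ∘ suc) y)
  ... | no _  = ℕ.m≤n⇒m≤1+n (multiplicity-≤ (F ∘ suc) y)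

  Fibre↔multiplicity : ∀ {n} (F : Fin n → B) y → Fibre F y ↔ Fin (multiplicity F y)
  Fibre↔multiplicity {zero}  F y = mk↔ₛ′ (λ ()) (λ ()) (λ ()) (λ ())
  Fibre↔multiplicity {suc n} F y =
    ↔-trans Σ-Fin-suc↔
      (↔-trans (indicator↔Fin ≡-irrelevant (F zero ≟ y) ⊎-↔ Fibre↔multiplicity (F ∘ suc) y) (↔-sym +↔⊎))
    where open Decidable⇒UIP _≟_ using (≡-irrelevant)

  same-multiplicity⇒permutation : ∀ {m n} (F : Fin m → B) (G : Fin n → B) →
    (∀ y → multiplicity F y ≡ multiplicity G y) → Σ[ π ∈ Permutation n m ] (∀ x → F (π ⟨$⟩ʳ x) ≡ G x)
  same-multiplicity⇒permutation F G F≡G = fibrewise-↔⇒↔ λ y →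
    ↔-trans (Fibre↔multiplicity F y) (subst (λ k → Fin k ↔ Fibre G y) (sym (F≡G y)) (↔-sym (Fibre↔multiplicity G y)))

module Fin-multiplicity {b} = Multiplicity (_≟ᶠ_ {b})
module ℕ-multiplicity = Multiplicity ℕ._≟_

fibreSize : ∀ {a b} → (Fin a → Fin b) → Fin b → ℕ
fibreSize = Fin-multiplicity.multiplicity

fibresOfSize : ∀ {a b} → ℕ → (Fin a → Fin b) → ℕ
fibresOfSize i F = ℕ-multiplicity.multiplicity (fibreSize F) i

fibreSize-∘-injective : ∀ {a b d} (F : Fin a → Fin b) {h : Fin b → Fin d} → Injective _≡_ _≡_ h →
                        ∀ y → fibreSize (h ∘ F) (h y) ≡ fibreSize F y
fibreSize-∘-injective F h-inj y = sum-cong-≗ λ x → indicator-cong h-inj (cong _) (_ ≟ᶠ _) (F x ≟ᶠ y)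

fibreSize-id : ∀ {n} (y : Fin n) → fibreSize id y ≡ 1
fibreSize-id {suc n} zero = cong suc (Fin-multiplicity.multiplicity-≡0 {b = suc n} {F = suc} {y = zero} λ _ ())
fibreSize-id (suc y)      = trans (fibreSize-∘-injective id suc-injective y) (fibreSize-id y)

↑ʳ≢↑ˡ : ∀ m {n} (u : Fin m) (v : Fin n) → m ↑ʳ v ≢ u ↑ˡ n
↑ʳ≢↑ˡ (suc m) zero    v ()
↑ʳ≢↑ˡ (suc m) (suc u) v e = ↑ʳ≢↑ˡ m u v (suc-injective e)

module _ {a b c d} (F : Fin a → Fin b) (G : Fin c → Fin d) where

  ⊔ᶠ-↑ˡ : ∀ x → (F ⊔ᶠ G) (x ↑ˡ c) ≡ F x ↑ˡ d
  ⊔ᶠ-↑ˡ x = cong [ _ , _ ] (splitAt-↑ˡ a x c)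

  ⊔ᶠ-↑ʳ : ∀ x → (F ⊔ᶠ G) (a ↑ʳ x) ≡ b ↑ʳ G x
  ⊔ᶠ-↑ʳ x = cong [ _ , _ ] (splitAt-↑ʳ a c x)

  fibreSize-⊔ᶠ-↑ˡ : ∀ y → fibreSize (F ⊔ᶠ G) (y ↑ˡ d) ≡ fibreSize F y
  fibreSize-⊔ᶠ-↑ˡ y = begin
    fibreSize (F ⊔ᶠ G) (y ↑ˡ d)
      ≡⟨ Fin-multiplicity.multiplicity-+ a (F ⊔ᶠ G) (y ↑ˡ d) ⟩
    fibreSize ((F ⊔ᶠ G) ∘ (_↑ˡ c)) (y ↑ˡ d) + fibreSize ((F ⊔ᶠ G) ∘ (a ↑ʳ_)) (y ↑ˡ d)
      ≡⟨ cong₂ _+_ (Fin-multiplicity.multiplicity-cong ⊔ᶠ-↑ˡ (y ↑ˡ d))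
                   (Fin-multiplicity.multiplicity-≡0 λ x e → ↑ʳ≢↑ˡ b y (G x) (trans (sym (⊔ᶠ-↑ʳ x)) e)) ⟩
    fibreSize ((_↑ˡ d) ∘ F) (y ↑ˡ d) + 0
      ≡⟨ ℕ.+-identityʳ _ ⟩
    fibreSize ((_↑ˡ d) ∘ F) (y ↑ˡ d)
      ≡⟨ fibreSize-∘-injective F (↑ˡ-injective d _ _) y ⟩
    fibreSize F y ∎
    where open ≡-Reasoning

  fibreSize-⊔ᶠ-↑ʳ : ∀ y → fibreSize (F ⊔ᶠ G) (b ↑ʳ y) ≡ fibreSize G y
  fibreSize-⊔ᶠ-↑ʳ y = begin
    fibreSize (F ⊔ᶠ G) (b ↑ʳ y)
      ≡⟨ Fin-multiplicity.multiplicity-+ a (F ⊔ᶠ G) (b ↑ʳ y) ⟩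
    fibreSize ((F ⊔ᶠ G) ∘ (_↑ˡ c)) (b ↑ʳ y) + fibreSize ((F ⊔ᶠ G) ∘ (a ↑ʳ_)) (b ↑ʳ y)
      ≡⟨ cong₂ _+_ (Fin-multiplicity.multiplicity-≡0 λ x e → ↑ʳ≢↑ˡ b (F x) y (trans (sym e) (⊔ᶠ-↑ˡ x)))
                   (Fin-multiplicity.multiplicity-cong ⊔ᶠ-↑ʳ (b ↑ʳ y)) ⟩
    fibreSize ((b ↑ʳ_) ∘ G) (b ↑ʳ y)
      ≡⟨ fibreSize-∘-injective G (↑ʳ-injective b _ _) y ⟩
    fibreSize G y ∎
    where open ≡-Reasoning

  fibresOfSize-⊔ᶠ : ∀ i → fibresOfSize i (F ⊔ᶠ G) ≡ fibresOfSize i F + fibresOfSize i G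
  fibresOfSize-⊔ᶠ i = trans (ℕ-multiplicity.multiplicity-+ b (fibreSize (F ⊔ᶠ G)) i)
    (cong₂ _+_ (ℕ-multiplicity.multiplicity-cong fibreSize-⊔ᶠ-↑ˡ i)
               (ℕ-multiplicity.multiplicity-cong fibreSize-⊔ᶠ-↑ʳ i))

⟨$⟩ʳ-injective : ∀ {m n} (π : Permutation m n) → Injective _≡_ _≡_ (π ⟨$⟩ʳ_)
⟨$⟩ʳ-injective π = Injection.injective (↔⇒↣ π)

Conjugate : ∀ {a b c d} → (Fin a → Fin b) → (Fin c → Fin d) → Set
Conjugate {a} {b} {c} {d} F G =
  Σ[ ξ₁ ∈ Permutation c a ] Σ[ ξ₂ ∈ Permutation b d ] (∀ x → ξ₂ ⟨$⟩ʳ F (ξ₁ ⟨$⟩ʳ x) ≡ G x)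

module _ {a b c d} {F : Fin a → Fin b} {G : Fin c → Fin d} where

  fibreSize-conjugate : ((ξ₁ , ξ₂ , _) : Conjugate F G) → ∀ y → fibreSize G (ξ₂ ⟨$⟩ʳ y) ≡ fibreSize F y
  fibreSize-conjugate (ξ₁ , ξ₂ , ξ₂∘F∘ξ₁≗G) y = begin
    fibreSize G (ξ₂ ⟨$⟩ʳ y)
      ≡⟨ Fin-multiplicity.multiplicity-cong (sym ∘ ξ₂∘F∘ξ₁≗G) (ξ₂ ⟨$⟩ʳ y) ⟩
    fibreSize ((ξ₂ ⟨$⟩ʳ_) ∘ F ∘ (ξ₁ ⟨$⟩ʳ_)) (ξ₂ ⟨$⟩ʳ y)
      ≡⟨ Fin-multiplicity.multiplicity-∘-permutation ((ξ₂ ⟨$⟩ʳ_) ∘ F) ξ₁ (ξ₂ ⟨$⟩ʳ y) ⟩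
    fibreSize ((ξ₂ ⟨$⟩ʳ_) ∘ F) (ξ₂ ⟨$⟩ʳ y)
      ≡⟨ fibreSize-∘-injective F (⟨$⟩ʳ-injective ξ₂) y ⟩
    fibreSize F y ∎
    where open ≡-Reasoning

  fibresOfSize-conjugate : Conjugate F G → ∀ i → fibresOfSize i F ≡ fibresOfSize i G
  fibresOfSize-conjugate F≅G@(_ , ξ₂ , _) i = begin
    fibresOfSize i F
      ≡⟨ ℕ-multiplicity.multiplicity-cong (sym ∘ fibreSize-conjugate F≅G) i ⟩
    ℕ-multiplicity.multiplicity (fibreSize G ∘ (ξ₂ ⟨$⟩ʳ_)) i
      ≡⟨ ℕ-multiplicity.multiplicity-∘-permutation (fibreSize G) ξ₂ i ⟩
    fibresOfSize i G ∎
    where open ≡-Reasoning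

  same-fibresOfSize⇒conjugate : (∀ i → fibresOfSize i F ≡ fibresOfSize i G) → Conjugate F G
  same-fibresOfSize⇒conjugate F≡G = ξ , ρ , λ x → trans (cong (ρ ⟨$⟩ʳ_) (proj₂ ξ-ok x)) (inverseʳ ρ)
    where
    ρ-sizes = ℕ-multiplicity.same-multiplicity⇒permutation (fibreSize G) (fibreSize F) (sym ∘ F≡G)
    ρ = proj₁ ρ-sizes
    H : Fin c → Fin b
    H x = ρ ⟨$⟩ˡ G x
    F≡H : ∀ y → fibreSize F y ≡ fibreSize H y
    F≡H y = begin
      fibreSize F y                    ≡⟨ proj₂ ρ-sizes y ⟨
      fibreSize G (ρ ⟨$⟩ʳ y)           ≡⟨ fibreSize-∘-injective G (⟨$⟩ʳ-injective (flip ρ)) (ρ ⟨$⟩ʳ y) ⟨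
      fibreSize H (ρ ⟨$⟩ˡ (ρ ⟨$⟩ʳ y)) ≡⟨ cong (fibreSize H) (inverseˡ ρ) ⟩
      fibreSize H y                    ∎
      where open ≡-Reasoning
    ξ-ok = Fin-multiplicity.same-multiplicity⇒permutation F H F≡H
    ξ = proj₁ ξ-ok

φ≡fibresOfSize : ∀ i f → φ i f ≡ fibresOfSize i (fun f)
φ≡fibresOfSize i f = trans (ℕ-multiplicity.length-filter-tabulate (preimageSize f) id i)
  (ℕ-multiplicity.multiplicity-cong (Fin-multiplicity.length-filter-tabulate (fun f) id) i)

φ-⊔ : ∀ i f g → φ i (f ⊔ g) ≡ φ i f + φ i g
φ-⊔ i f g = begin
  φ i (f ⊔ g)                                   ≡⟨ φ≡fibresOfSize i (f ⊔ g) ⟩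
  fibresOfSize i (fun f ⊔ᶠ fun g)               ≡⟨ fibresOfSize-⊔ᶠ (fun f) (fun g) i ⟩
  fibresOfSize i (fun f) + fibresOfSize i (fun g) ≡⟨ cong₂ _+_ (φ≡fibresOfSize i f) (φ≡fibresOfSize i g) ⟨
  φ i f + φ i g ∎
  where open ≡-Reasoning

φ-≡0-beyond-dom : ∀ f i → dom f < i → φ i f ≡ 0
φ-≡0-beyond-dom f i dom<i = trans (φ≡fibresOfSize i f) (ℕ-multiplicity.multiplicity-≡0 λ y →
  ℕ.<⇒≢ (ℕ.≤-<-trans (Fin-multiplicity.multiplicity-≤ (fun f) y) dom<i))

conjugate⇒φ-≡ : ∀ f g → Conjugate (fun f) (fun g) → ∀ i → φ i f ≡ φ i g
conjugate⇒φ-≡ f g f≅g i = begin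
  φ i f                  ≡⟨ φ≡fibresOfSize i f ⟩
  fibresOfSize i (fun f) ≡⟨ fibresOfSize-conjugate f≅g i ⟩
  fibresOfSize i (fun g) ≡⟨ φ≡fibresOfSize i g ⟨
  φ i g ∎
  where open ≡-Reasoning

φ-≡⇒conjugate : ∀ f g → (∀ i → φ i f ≡ φ i g) → Conjugate (fun f) (fun g)
φ-≡⇒conjugate f g f≡g = same-fibresOfSize⇒conjugate λ i →
  trans (sym (φ≡fibresOfSize i f)) (trans (f≡g i) (φ≡fibresOfSize i g))

idFun : ℕ → FinFun
idFun z = mkFun z z id

φ-idFun : ∀ z i → i ≢ 1 → φ i (idFun z) ≡ 0
φ-idFun z i i≢1 = trans (φ≡fibresOfSize i (idFun z))
  (ℕ-multiplicity.multiplicity-≡0 {F = fibreSize {z} id} λ y e → i≢1 (trans (sym e) (fibreSize-id y)))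

φ₁-idFun : ∀ z → φ 1 (idFun z) ≡ z
φ₁-idFun z = trans (φ≡fibresOfSize 1 (idFun z)) (ℕ-multiplicity.multiplicity-≡n fibreSize-id)

≽⇒stably-conjugate : ∀ {f g} → f ≽ g → Σ[ z ∈ ℕ ] Σ[ j ∈ FinFun ] Conjugate (fun (f ⊔ idFun z)) (fun (g ⊔ j))
≽⇒stably-conjugate (z , w , w′ , ξ₁ , ξ₂ , j , eq) = z , mkFun w w′ j , ⤖⇒↔ ξ₁ , ⤖⇒↔ ξ₂ , eq

stably-conjugate⇒≽ : ∀ {f g} z j → Conjugate (fun (f ⊔ idFun z)) (fun (g ⊔ j)) → f ≽ g
stably-conjugate⇒≽ z j (ξ₁ , ξ₂ , eq) = z , dom j , cod j , ↔⇒⤖ ξ₁ , ↔⇒⤖ ξ₂ , fun j , eq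

≽⇒φ-≥ : ∀ f g → f ≽ g → ∀ i → i ≢ 1 → φ i g ≤ φ i f
≽⇒φ-≥ f g f≽g i i≢1 = begin
  φ i g                     ≤⟨ ℕ.m≤m+n (φ i g) (φ i j) ⟩
  φ i g + φ i j             ≡⟨ φ-⊔ i g j ⟨
  φ i (g ⊔ j)               ≡⟨ conjugate⇒φ-≡ (f ⊔ idFun z) (g ⊔ j) f⊔z≅g⊔j i ⟨
  φ i (f ⊔ idFun z)         ≡⟨ φ-⊔ i f (idFun z) ⟩
  φ i f + φ i (idFun z)     ≡⟨ cong (φ i f +_) (φ-idFun z i i≢1) ⟩
  φ i f + 0                 ≡⟨ ℕ.+-identityʳ (φ i f) ⟩
  φ i f ∎
  where
  open ℕ.≤-Reasoning
  z = proj₁ (≽⇒stably-conjugate f≽g)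
  j = proj₁ (proj₂ (≽⇒stably-conjugate f≽g))
  f⊔z≅g⊔j = proj₂ (proj₂ (≽⇒stably-conjugate f≽g))

constFun : ℕ → FinFun
constFun n = mkFun n 1 (λ _ → zero)

φ-constFun : ∀ n i → φ i (constFun n) ≡ indicator (n ℕ.≟ i)
φ-constFun n i = trans (φ≡fibresOfSize i (constFun n)) (trans (ℕ.+-identityʳ _)
  (cong (λ k → indicator (k ℕ.≟ i)) (Fin-multiplicity.multiplicity-≡n {b = 1} {F = λ (_ : Fin n) → zero} λ _ → refl)))

copies : ℕ → FinFun → FinFun
copies zero    f = emptyFun
copies (suc k) f = f ⊔ copies k f

φ-copies : ∀ k f i → φ i (copies k f) ≡ k * φ i f
φ-copies zero    f i = refl
φ-copies (suc k) f i = trans (φ-⊔ i f (copies k f)) (cong (φ i f +_) (φ-copies k f i))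

realise : (ℕ → ℕ) → ℕ → FinFun
realise h zero    = emptyFun
realise h (suc N) = realise h N ⊔ copies (h N) (constFun N)

φ-realise-suc : ∀ h N i → φ i (realise h (suc N)) ≡ φ i (realise h N) + h N * indicator (N ℕ.≟ i)
φ-realise-suc h N i = trans (φ-⊔ i (realise h N) _)
  (cong (φ i (realise h N) +_) (trans (φ-copies (h N) (constFun N) i) (cong (h N *_) (φ-constFun N i))))

φ-realise-≥ : ∀ h N i → N ≤ i → φ i (realise h N) ≡ 0
φ-realise-≥ h zero    i _   = refl
φ-realise-≥ h (suc N) i N<i = begin
  φ i (realise h (suc N))                        ≡⟨ φ-realise-suc h N i ⟩
  φ i (realise h N) + h N * indicator (N ℕ.≟ i)   ≡⟨ cong₂ _+_ (φ-realise-≥ h N i (ℕ.<⇒≤ N<i))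
                                                               (cong (h N *_) (indicator-no (ℕ.<⇒≢ N<i) _)) ⟩
  h N * 0                                        ≡⟨ ℕ.*-zeroʳ (h N) ⟩
  0 ∎
  where open ≡-Reasoning

φ-realise-< : ∀ h N i → i < N → φ i (realise h N) ≡ h i
φ-realise-< h (suc N) i i<1+N with ℕ.m<1+n⇒m<n∨m≡n i<1+N
... | inj₁ i<N = begin
  φ i (realise h (suc N))                        ≡⟨ φ-realise-suc h N i ⟩
  φ i (realise h N) + h N * indicator (N ℕ.≟ i)   ≡⟨ cong₂ _+_ (φ-realise-< h N i i<N)
                                                               (cong (h N *_) (indicator-no (ℕ.<⇒≢ i<N ∘ sym) _)) ⟩
  h i + h N * 0                                  ≡⟨ cong (h i +_) (ℕ.*-zeroʳ (h N)) ⟩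
  h i + 0                                        ≡⟨ ℕ.+-identityʳ (h i) ⟩
  h i ∎
  where open ≡-Reasoning
... | inj₂ refl = begin
  φ i (realise h (suc i))                        ≡⟨ φ-realise-suc h i i ⟩
  φ i (realise h i) + h i * indicator (i ℕ.≟ i)   ≡⟨ cong₂ _+_ (φ-realise-≥ h i i ℕ.≤-refl)
                                                               (cong (h i *_) (indicator-yes refl _)) ⟩
  h i * 1                                        ≡⟨ ℕ.*-identityʳ (h i) ⟩
  h i ∎
  where open ≡-Reasoning

φ-realise : ∀ h → ((N , _) : FinSupp h) → ∀ i → i ≢ 1 → φ i (realise h N) ≡ h i
φ-realise h (N , h-vanishes) i i≢1 with i ℕ.<? N
... | yes i<N = φ-realise-< h N i i<N
... | no  i≮N = trans (φ-realise-≥ h N i (ℕ.≮⇒≥ i≮N)) (sym (h-vanishes i (ℕ.≮⇒≥ i≮N) i≢1))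

φ-≥⇒≽ : ∀ f g → (∀ i → i ≢ 1 → φ i g ≤ φ i f) → f ≽ g
φ-≥⇒≽ f g g≤f = stably-conjugate⇒≽ z j (φ-≡⇒conjugate (f ⊔ idFun z) (g ⊔ j) λ i →
  trans (φ-⊔ i f (idFun z)) (trans (same-sums i) (sym (φ-⊔ i g j))))
  where
  open ≡-Reasoning
  z = φ 1 g
  -- On the left the identity on z points contributes z = φ₁ g, so j has to supply φ₁ f.
  excess : ℕ → ℕ
  excess 0               = φ 0 f ∸ φ 0 g
  excess 1               = φ 1 f
  excess i@(suc (suc _)) = φ i f ∸ φ i g
  excess-≢1 : ∀ i → i ≢ 1 → excess i ≡ φ i f ∸ φ i g
  excess-≢1 0             _   = refl
  excess-≢1 1             1≢1 = ⊥-elim (1≢1 refl)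
  excess-≢1 (suc (suc _)) _   = refl
  N = 2 + dom f
  excess-finSupp : FinSupp excess
  excess-finSupp = N , λ i N≤i i≢1 → begin
    excess i          ≡⟨ excess-≢1 i i≢1 ⟩
    φ i f ∸ φ i g     ≡⟨ cong (_∸ φ i g) (φ-≡0-beyond-dom f i (ℕ.<⇒≤ N≤i)) ⟩
    0 ∸ φ i g         ≡⟨ ℕ.0∸n≡0 (φ i g) ⟩
    0 ∎
  j = realise excess N
  same-sums-≢1 : ∀ i → i ≢ 1 → φ i f + φ i (idFun z) ≡ φ i g + φ i j
  same-sums-≢1 i i≢1 = begin
    φ i f + φ i (idFun z)   ≡⟨ cong (φ i f +_) (φ-idFun z i i≢1) ⟩
    φ i f + 0               ≡⟨ ℕ.+-identityʳ (φ i f) ⟩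
    φ i f                   ≡⟨ ℕ.m+[n∸m]≡n (g≤f i i≢1) ⟨
    φ i g + (φ i f ∸ φ i g) ≡⟨ cong (φ i g +_) (trans (φ-realise excess excess-finSupp i i≢1) (excess-≢1 i i≢1)) ⟨
    φ i g + φ i j           ∎
  same-sums : ∀ i → φ i f + φ i (idFun z) ≡ φ i g + φ i j
  same-sums 1 = begin
    φ 1 f + φ 1 (idFun z)  ≡⟨ cong (φ 1 f +_) (φ₁-idFun z) ⟩
    φ 1 f + φ 1 g          ≡⟨ ℕ.+-comm (φ 1 f) (φ 1 g) ⟩
    φ 1 g + φ 1 f          ≡⟨ cong (φ 1 g +_) (φ-realise-< excess N 1 (s≤s (s≤s z≤n))) ⟨
    φ 1 g + φ 1 j ∎
  same-sums i@0             = same-sums-≢1 i λ ()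
  same-sums i@(suc (suc _)) = same-sums-≢1 i λ ()

corollary4p2 : (∀ f → FinSupp (λ i → φ i f))
    × (∀ f g → f ≈ g → ∀ i → i ≢ 1 → φ i f ≡ φ i g)
    × (∀ f g i → i ≢ 1 → φ i (f ⊔ g) ≡ φ i f + φ i g)
    × (∀ i → i ≢ 1 → φ i emptyFun ≡ 0)
    × (∀ f g → (f ≽ g) ⇔ (∀ i → i ≢ 1 → φ i g ≤ φ i f))
    × (∀ f g → (∀ i → i ≢ 1 → φ i f ≡ φ i g) → f ≈ g)
    × (∀ h → FinSupp h → Σ[ f ∈ FinFun ] (∀ i → i ≢ 1 → φ i f ≡ h i))
corollary4p2 =
    (λ f → suc (dom f) , λ i dom<i _ → φ-≡0-beyond-dom f i dom<i)
  , (λ f g (f≽g , g≽f) i i≢1 → ℕ.≤-antisym (≽⇒φ-≥ g f g≽f i i≢1) (≽⇒φ-≥ f g f≽g i i≢1))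
  , (λ f g i _ → φ-⊔ i f g)
  , (λ i _ → refl)
  , (λ f g → mk⇔ (≽⇒φ-≥ f g) (φ-≥⇒≽ f g))
  , (λ f g f≡g → φ-≥⇒≽ f g (λ i i≢1 → ℕ.≤-reflexive (sym (f≡g i i≢1)))
               , φ-≥⇒≽ g f (λ i i≢1 → ℕ.≤-reflexive (f≡g i i≢1)))
  , (λ h h-finSupp → realise h (proj₁ h-finSupp) , φ-realise h h-finSupp)
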